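{- The category $\mathcal{iOS}$ does not have equalisers or coequalisers; that is, there exist pairs of parallel morphisms in $\mathcal{iOS}$ without an equaliser, and pairs without a coequaliser.
   Context: An orthoset (with $0$) is a non-empty set $X$ with a binary relation $\perp$ and element $0$ such that: $\perp$ is symmetric; $x\perp x$ iff $x=0$; $0\perp x$ for all $x$. $X$ is irredundant if for nonzero $x,y$, $\{x\}^\perp=\{y\}^\perp$ implies $x=y$, where $\{x\}^\perp=\{z: z\perp x\}$. A map $f\colon X\to Y$ is adjointable if there is $g\colon Y\to X$ with $f(x)\perp y\iff x\perp g(y)$ for all $x,y$. $\mathcal{iOS}$ is the category of irredundant orthosets and adjointable maps. -}

module Defs where

open import Level using (Level; suc; _⊔_; 0ℓ)
open import Data.Product using (Σ; ∃; _×_; _,_; proj₁; proj₂)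
open import Relation.Binary.PropositionalEquality using (_≡_)
open import Relation.Nullary using (¬_)
open import Function.Bundles using (_⇔_)

-- An orthoset with 0: a carrier, a binary relation ⊥ and a distinguished 0 with
-- ⊥ symmetric, x ⊥ x iff x = 0, and 0 ⊥ x for all x.
-- (Non-emptiness is automatic since 0 is an element.)
record Orthoset : Set₁ where
  field
    Carrier : Set
    _⊥_     : Carrier → Carrier → Set
    𝟘       : Carrier
    ⊥-sym   : ∀ {x y} → x ⊥ y → y ⊥ x
    ⊥-self  : ∀ x → (x ⊥ x) ⇔ (x ≡ 𝟘)
    𝟘-⊥     : ∀ x → 𝟘 ⊥ x

open Orthoset public

SamePerp : (X : Orthoset) → Carrier X → Carrier X → Set
SamePerp X x y = ∀ z → (_⊥_ X z x) ⇔ (_⊥_ X z y)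

Irredundant : Orthoset → Set
Irredundant X = ∀ x y → ¬ (x ≡ 𝟘 X) → ¬ (y ≡ 𝟘 X) → SamePerp X x y → x ≡ y

record IOS : Set₁ where
  field
    orthoset    : Orthoset
    irredundant : Irredundant orthoset

open IOS public

∣_∣ : IOS → Set
∣ X ∣ = Carrier (orthoset X)


Adjointable : (X Y : IOS) → (∣ X ∣ → ∣ Y ∣) → Set
Adjointable X Y f =
  Σ (∣ Y ∣ → ∣ X ∣) λ g → ∀ x y → (_⊥_ (orthoset Y) (f x) y) ⇔ (_⊥_ (orthoset X) x (g y))

-- Morphisms of iOS: adjointable maps (a map together with the property of
-- having an adjoint; packaged as a record so that X, Y are inferable).
record Hom (X Y : IOS) : Set where
  constructor hom
  field
    app  : ∣ X ∣ → ∣ Y ∣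
    adjointable : Adjointable X Y app

open Hom public

infixr 9 _∘ₕ_
infix 4 _≈ₕ_

_∘ₕ_ : {X Y Z : IOS} → Hom Y Z → Hom X Y → Hom X Z
_∘ₕ_ {X} {Y} {Z} (hom f (f* , pf)) (hom g (g* , pg)) =
  hom (λ x → f (g x)) ((λ z → g* (f* z)) ,
  λ x z → let open Function.Bundles.Equivalence in
    record { to   = λ h → to (pg x (f* z)) (to (pf (g x) z) h)
           ; from = λ h → from (pf (g x) z) (from (pg x (f* z)) h)
           ; to-cong = λ { _≡_.refl → _≡_.refl }
           ; from-cong = λ { _≡_.refl → _≡_.refl } })

_≈ₕ_ : {X Y : IOS} → Hom X Y → Hom X Y → Set
f ≈ₕ g = ∀ x → app f x ≡ app g x

IsEqualiser : {X Y : IOS} (f g : Hom X Y) (E : IOS) (e : Hom E X) → Set₁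
IsEqualiser {X} f g E e =
  ((f ∘ₕ e) ≈ₕ (g ∘ₕ e)) ×
  (∀ (Z : IOS) (h : Hom Z X) → (f ∘ₕ h) ≈ₕ (g ∘ₕ h) →
     Σ (Hom Z E) λ u → ((e ∘ₕ u) ≈ₕ h) ×
       (∀ (u' : Hom Z E) → (e ∘ₕ u') ≈ₕ h → u' ≈ₕ u))

HasEqualiser : {X Y : IOS} (f g : Hom X Y) → Set₁
HasEqualiser {X} f g = Σ IOS λ E → Σ (Hom E X) λ e → IsEqualiser f g E e

IsCoequaliser : {X Y : IOS} (f g : Hom X Y) (C : IOS) (c : Hom Y C) → Set₁
IsCoequaliser {X} {Y} f g C c =
  ((c ∘ₕ f) ≈ₕ (c ∘ₕ g)) ×
  (∀ (Z : IOS) (h : Hom Y Z) → (h ∘ₕ f) ≈ₕ (h ∘ₕ g) →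
     Σ (Hom C Z) λ u → ((u ∘ₕ c) ≈ₕ h) ×
       (∀ (u' : Hom C Z) → (u' ∘ₕ c) ≈ₕ h → u' ≈ₕ u))

HasCoequaliser : {X Y : IOS} (f g : Hom X Y) → Set₁
HasCoequaliser {Y = Y} f g = Σ IOS λ C → Σ (Hom Y C) λ c → IsCoequaliser f g C c

-- Take X with two orthogonal pairs a ⊥ b, c ⊥ d, and the swap sw of c and d. An equaliser
-- e of id and sw, and likewise the adjoint of a coequaliser, is an adjointable map into X
-- whose image lies in the fixed set {0, a, b} and contains a and b (test it against the
-- points 𝟚 → X and their adjoints). No such map exists: as a and b are in the image, e* c ≠ 0,
-- so e (e* c) is a or b, say a; then e* b ⊥ e* c gives e (e* b) ⊥ c, so e (e* b) = 0 and
-- hence e* b = 0, contradicting b being in the image.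
module Submission where

open import Defs
open import Data.Empty using (⊥; ⊥-elim)
open import Data.Product using (Σ; ∃; _×_; _,_; proj₁; proj₂)
open import Data.Sum using (_⊎_; inj₁; inj₂)
open import Function.Bundles using (_⇔_; mk⇔; Equivalence)
open import Function.Construct.Composition using (_⇔-∘_)
open import Function.Construct.Symmetry using (⇔-sym)
open import Relation.Binary.PropositionalEquality using (_≡_; _≢_; refl; sym; trans; subst)
open import Relation.Nullary using (¬_; Dec; yes; no)
import Relation.Nullary.Decidable as Dec
open Equivalence using (to; from)

⊥-syntax : (X : IOS) → ∣ X ∣ → ∣ X ∣ → Set
⊥-syntax X = _⊥_ (orthoset X)

syntax ⊥-syntax X x y = x ⊥⟨ X ⟩ y

𝟘⟨_⟩ : (X : IOS) → ∣ X ∣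
𝟘⟨ X ⟩ = 𝟘 (orthoset X)

DecidablePerp : IOS → Set
DecidablePerp X = ∀ x y → Dec (x ⊥⟨ X ⟩ y)

module _ (X : IOS) where

  ⊥-𝟘 : ∀ x → x ⊥⟨ X ⟩ 𝟘⟨ X ⟩
  ⊥-𝟘 x = ⊥-sym (orthoset X) (𝟘-⊥ (orthoset X) x)

  ⊥-self⇒≡𝟘 : ∀ {x} → x ⊥⟨ X ⟩ x → x ≡ 𝟘⟨ X ⟩
  ⊥-self⇒≡𝟘 {x} = to (⊥-self (orthoset X) x)

  ≡𝟘? : DecidablePerp X → ∀ x → Dec (x ≡ 𝟘⟨ X ⟩)
  ≡𝟘? _⊥?_ x = Dec.map (⊥-self (orthoset X) x) (x ⊥? x)

  samePerp-≡𝟘 : ∀ {x y} → SamePerp (orthoset X) x y → y ≡ 𝟘⟨ X ⟩ → x ≡ 𝟘⟨ X ⟩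
  samePerp-≡𝟘 {x} x~y refl = ⊥-self⇒≡𝟘 (from (x~y x) (⊥-𝟘 x))

  -- Irredundancy only speaks about nonzero elements; the zero case is settled by ⊥-self.
  samePerp⇒≡ : ∀ {x y} → Dec (x ≡ 𝟘⟨ X ⟩) → SamePerp (orthoset X) x y → x ≡ y
  samePerp⇒≡ (yes x≡𝟘) x~y = trans x≡𝟘 (sym (samePerp-≡𝟘 (λ z → ⇔-sym (x~y z)) x≡𝟘))
  samePerp⇒≡ (no x≢𝟘)  x~y =
    irredundant X _ _ x≢𝟘 (λ y≡𝟘 → x≢𝟘 (samePerp-≡𝟘 x~y y≡𝟘)) x~y

idₕ : {X : IOS} → Hom X X
idₕ = hom (λ x → x) ((λ x → x) , λ _ _ → mk⇔ (λ p → p) (λ p → p))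

module _ {X Y : IOS} (f : Hom X Y) where

  adjoint : ∣ Y ∣ → ∣ X ∣
  adjoint = proj₁ (adjointable f)

  adjunction : ∀ x y → (app f x ⊥⟨ Y ⟩ y) ⇔ (x ⊥⟨ X ⟩ adjoint y)
  adjunction = proj₂ (adjointable f)

  _† : Hom Y X
  _† = hom adjoint (app f , λ y x →
    mk⇔ (λ h → ⊥-sym (orthoset Y) (from (adjunction x y) (⊥-sym (orthoset X) h)))
        (λ h → ⊥-sym (orthoset X) (to (adjunction x y) (⊥-sym (orthoset Y) h))))

  adjoint-≢𝟘 : ∀ {x y} → ¬ (app f x ⊥⟨ Y ⟩ y) → adjoint y ≢ 𝟘⟨ X ⟩
  adjoint-≢𝟘 {x} {y} fx⊥̸y f*y≡𝟘 =
    fx⊥̸y (from (adjunction x y) (subst (λ v → x ⊥⟨ X ⟩ v) (sym f*y≡𝟘) (⊥-𝟘 X x)))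

  app-adjoint-≡𝟘 : ∀ {y} → app f (adjoint y) ≡ 𝟘⟨ Y ⟩ → adjoint y ≡ 𝟘⟨ X ⟩
  app-adjoint-≡𝟘 {y} ff*y≡𝟘 =
    ⊥-self⇒≡𝟘 X (to (adjunction (adjoint y) y) (subst (λ v → v ⊥⟨ Y ⟩ y) (sym ff*y≡𝟘) (𝟘-⊥ (orthoset Y) y)))

adjoint-unique : {X Y : IOS} → (∀ x → Dec (x ≡ 𝟘⟨ X ⟩)) → (f g : Hom X Y) →
                 f ≈ₕ g → ∀ y → adjoint f y ≡ adjoint g y
adjoint-unique {X} {Y} ≡𝟘?ˣ f g f≈g y = samePerp⇒≡ X (≡𝟘?ˣ (adjoint f y)) f*y~g*y
  where
  f*y~g*y : SamePerp (orthoset X) (adjoint f y) (adjoint g y)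
  f*y~g*y w = subst (λ v → (v ⊥⟨ Y ⟩ y) ⇔ (w ⊥⟨ X ⟩ adjoint g y)) (sym (f≈g w)) (adjunction g w y)
              ⇔-∘ ⇔-sym (adjunction f w y)

involution-adjointable : (X : IOS) (σ : ∣ X ∣ → ∣ X ∣) → (∀ x → σ (σ x) ≡ x) →
                         (∀ {x y} → x ⊥⟨ X ⟩ y → σ x ⊥⟨ X ⟩ σ y) → Adjointable X X σ
involution-adjointable X σ σσ≡id σ-preserves-⊥ = σ , λ x y →
  mk⇔ (λ σx⊥y → subst (λ v → v ⊥⟨ X ⟩ σ y) (σσ≡id x) (σ-preserves-⊥ σx⊥y))
      (λ x⊥σy → subst (λ v → σ x ⊥⟨ X ⟩ v) (σσ≡id y) (σ-preserves-⊥ x⊥σy))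

data Two : Set where
  zero₂ one₂ : Two

data _⊥₂_ : Two → Two → Set where
  zero₂⊥ : ∀ {w} → zero₂ ⊥₂ w
  ⊥zero₂ : ∀ {w} → w ⊥₂ zero₂

𝟚 : IOS
𝟚 = record
  { orthoset = record
    { Carrier = Two ; _⊥_ = _⊥₂_ ; 𝟘 = zero₂
    ; ⊥-sym = λ { zero₂⊥ → ⊥zero₂ ; ⊥zero₂ → zero₂⊥ }
    ; ⊥-self = λ _ → mk⇔ (λ { zero₂⊥ → refl ; ⊥zero₂ → refl }) (λ { refl → zero₂⊥ })
    ; 𝟘-⊥ = λ _ → zero₂⊥ }
  ; irredundant = λ
    { zero₂ _ x≢𝟘 _ _ → ⊥-elim (x≢𝟘 refl)
    ; _ zero₂ _ y≢𝟘 _ → ⊥-elim (y≢𝟘 refl)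
    ; one₂ one₂ _ _ _ → refl } }

≡zero₂? : ∀ w → Dec (w ≡ zero₂)
≡zero₂? zero₂ = yes refl
≡zero₂? one₂  = no λ ()

module _ (X : IOS) (_⊥?_ : DecidablePerp X) where

  point-adjoint : ∀ {x y} → Dec (x ⊥⟨ X ⟩ y) → Two
  point-adjoint (yes _) = zero₂
  point-adjoint (no _)  = one₂

  point-app : ∣ X ∣ → Two → ∣ X ∣
  point-app _ zero₂ = 𝟘⟨ X ⟩
  point-app x one₂  = x

  point-adjunction : ∀ x w y → (point-app x w ⊥⟨ X ⟩ y) ⇔ (w ⊥₂ point-adjoint (x ⊥? y))
  point-adjunction x zero₂ y = mk⇔ (λ _ → zero₂⊥) (λ _ → 𝟘-⊥ (orthoset X) y)
  point-adjunction x one₂ y with x ⊥? y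
  ... | yes x⊥y = mk⇔ (λ _ → ⊥zero₂) (λ _ → x⊥y)
  ... | no x⊥̸y = mk⇔ (λ x⊥y → ⊥-elim (x⊥̸y x⊥y)) (λ ())

  point : ∣ X ∣ → Hom 𝟚 X
  point x = hom (point-app x) ((λ y → point-adjoint (x ⊥? y)) , point-adjunction x)

data El : Set where
  z a b c d : El

data _⊥ₓ_ : El → El → Set where
  z⊥  : ∀ {x} → z ⊥ₓ x
  ⊥z  : ∀ {x} → x ⊥ₓ z
  a⊥b : a ⊥ₓ b
  b⊥a : b ⊥ₓ a
  c⊥d : c ⊥ₓ d
  d⊥c : d ⊥ₓ c

⊥ₓ-sym : ∀ {x y} → x ⊥ₓ y → y ⊥ₓ x
⊥ₓ-sym z⊥  = ⊥z
⊥ₓ-sym ⊥z  = z⊥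
⊥ₓ-sym a⊥b = b⊥a
⊥ₓ-sym b⊥a = a⊥b
⊥ₓ-sym c⊥d = d⊥c
⊥ₓ-sym d⊥c = c⊥d

⊥ₓ-self : ∀ x → (x ⊥ₓ x) ⇔ (x ≡ z)
⊥ₓ-self _ = mk⇔ (λ { z⊥ → refl ; ⊥z → refl }) (λ { refl → z⊥ })

partner : El → El
partner z = z
partner a = b
partner b = a
partner c = d
partner d = c

partner-⊥ : ∀ x → partner x ⊥ₓ x
partner-⊥ z = z⊥
partner-⊥ a = b⊥a
partner-⊥ b = a⊥b
partner-⊥ c = d⊥c
partner-⊥ d = c⊥d

partner-⊥⇒≡ : ∀ x {y} → x ≢ z → y ≢ z → partner x ⊥ₓ y → x ≡ y
partner-⊥⇒≡ z x≢z _   _    = ⊥-elim (x≢z refl)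
partner-⊥⇒≡ _ _    y≢z ⊥z  = ⊥-elim (y≢z refl)
partner-⊥⇒≡ a _    _   b⊥a = refl
partner-⊥⇒≡ b _    _   a⊥b = refl
partner-⊥⇒≡ c _    _   d⊥c = refl
partner-⊥⇒≡ d _    _   c⊥d = refl

𝕏 : IOS
𝕏 = record
  { orthoset = record
    { Carrier = El ; _⊥_ = _⊥ₓ_ ; 𝟘 = z
    ; ⊥-sym = ⊥ₓ-sym ; ⊥-self = ⊥ₓ-self ; 𝟘-⊥ = λ _ → z⊥ }
  ; irredundant = λ x y x≢z y≢z x~y → partner-⊥⇒≡ x x≢z y≢z (to (x~y (partner x)) (partner-⊥ x)) }

_⊥ₓ?_ : DecidablePerp 𝕏
z ⊥ₓ? _ = yes z⊥
_ ⊥ₓ? z = yes ⊥z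
a ⊥ₓ? a = no λ ()
a ⊥ₓ? b = yes a⊥b
a ⊥ₓ? c = no λ ()
a ⊥ₓ? d = no λ ()
b ⊥ₓ? a = yes b⊥a
b ⊥ₓ? b = no λ ()
b ⊥ₓ? c = no λ ()
b ⊥ₓ? d = no λ ()
c ⊥ₓ? a = no λ ()
c ⊥ₓ? b = no λ ()
c ⊥ₓ? c = no λ ()
c ⊥ₓ? d = yes c⊥d
d ⊥ₓ? a = no λ ()
d ⊥ₓ? b = no λ ()
d ⊥ₓ? c = yes d⊥c
d ⊥ₓ? d = no λ ()

sw : El → El
sw c = d
sw d = c
sw x = x

sw-involutive : ∀ x → sw (sw x) ≡ x
sw-involutive z = refl
sw-involutive a = refl
sw-involutive b = refl
sw-involutive c = refl
sw-involutive d = refl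

sw-preserves-⊥ : ∀ {x y} → x ⊥ₓ y → sw x ⊥ₓ sw y
sw-preserves-⊥ z⊥  = z⊥
sw-preserves-⊥ ⊥z  = ⊥z
sw-preserves-⊥ a⊥b = a⊥b
sw-preserves-⊥ b⊥a = b⊥a
sw-preserves-⊥ c⊥d = d⊥c
sw-preserves-⊥ d⊥c = c⊥d

swₕ : Hom 𝕏 𝕏
swₕ = hom sw (involution-adjointable 𝕏 sw sw-involutive sw-preserves-⊥)

sw-fixed⇒z⊎a⊎b : ∀ {x} → sw x ≡ x → x ≡ z ⊎ x ≡ a ⊎ x ≡ b
sw-fixed⇒z⊎a⊎b {z} _ = inj₁ refl
sw-fixed⇒z⊎a⊎b {a} _ = inj₂ (inj₁ refl)
sw-fixed⇒z⊎a⊎b {b} _ = inj₂ (inj₂ refl)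

sw-fixed-⊥c⇒≡z : ∀ {x} → sw x ≡ x → x ⊥ₓ c → x ≡ z
sw-fixed-⊥c⇒≡z _  z⊥  = refl
sw-fixed-⊥c⇒≡z () d⊥c

fixed-points-not-an-image : (E : IOS) (e : Hom E 𝕏) → (∀ p → sw (app e p) ≡ app e p) →
                            (∃ λ p → app e p ≡ a) → (∃ λ p → app e p ≡ b) → ⊥
fixed-points-not-an-image E e fixed (pa , epa≡a) (pb , epb≡b) = by-cases (sw-fixed⇒z⊎a⊎b (fixed q))
  where
  q : ∣ E ∣
  q = adjoint e c

  partner-not-in-image : ∀ {t t'} → app e q ≡ t → t ⊥ₓ t' → ¬ (t' ⊥ₓ t') → ∀ p → app e p ≡ t' → ⊥
  partner-not-in-image {t' = t'} eq≡t t⊥t' t'⊥̸t' p ep≡t' =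
    adjoint-≢𝟘 e (subst (λ v → ¬ (v ⊥ₓ t')) (sym ep≡t') t'⊥̸t') (app-adjoint-≡𝟘 e er≡z)
    where
    q⊥e*t' : q ⊥⟨ E ⟩ adjoint e t'
    q⊥e*t' = to (adjunction e q t') (subst (λ v → v ⊥ₓ t') (sym eq≡t) t⊥t')
    er≡z : app e (adjoint e t') ≡ z
    er≡z = sw-fixed-⊥c⇒≡z (fixed _) (from (adjunction e _ c) (⊥-sym (orthoset E) q⊥e*t'))

  by-cases : app e q ≡ z ⊎ app e q ≡ a ⊎ app e q ≡ b → ⊥
  by-cases (inj₁ eq≡z)        = adjoint-≢𝟘 e (subst (λ v → ¬ (v ⊥ₓ c)) (sym epa≡a) λ ()) (app-adjoint-≡𝟘 e eq≡z)
  by-cases (inj₂ (inj₁ eq≡a)) = partner-not-in-image eq≡a a⊥b (λ ()) pb epb≡b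
  by-cases (inj₂ (inj₂ eq≡b)) = partner-not-in-image eq≡b b⊥a (λ ()) pa epa≡a

pt : El → Hom 𝟚 𝕏
pt = point 𝕏 _⊥ₓ?_

pt-equalises : ∀ {t} → sw t ≡ t → (idₕ ∘ₕ pt t) ≈ₕ (swₕ ∘ₕ pt t)
pt-equalises _       zero₂ = refl
pt-equalises t-fixed one₂  = sym t-fixed

no-equaliser : ¬ HasEqualiser idₕ swₕ
no-equaliser (E , e , e-equalises , factorise) =
  fixed-points-not-an-image E e (λ p → sym (e-equalises p)) (in-image refl) (in-image refl)
  where
  in-image : ∀ {t} → sw t ≡ t → ∃ λ p → app e p ≡ t
  in-image t-fixed with factorise 𝟚 (pt _) (pt-equalises t-fixed)
  ... | u , e∘u≈pt , _ = app u one₂ , e∘u≈pt one₂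

no-coequaliser : ¬ HasCoequaliser idₕ swₕ
no-coequaliser (C , q , q-coequalises , factorise) =
  fixed-points-not-an-image C (q †) q*-fixed (in-image refl) (in-image refl)
  where
  ≡z? : ∀ x → Dec (x ≡ z)
  ≡z? = ≡𝟘? 𝕏 _⊥ₓ?_

  q*-fixed : ∀ p → sw (adjoint q p) ≡ adjoint q p
  q*-fixed p = sym (adjoint-unique ≡z? (q ∘ₕ idₕ) (q ∘ₕ swₕ) q-coequalises p)

  in-image : ∀ {t} → sw t ≡ t → ∃ λ p → adjoint q p ≡ t
  in-image t-fixed with factorise 𝟚 (pt _ †) (adjoint-unique ≡zero₂? (idₕ ∘ₕ pt _) (swₕ ∘ₕ pt _) (pt-equalises t-fixed))
  ... | u , u∘q≈pt† , _ = adjoint u one₂ , adjoint-unique ≡z? (u ∘ₕ q) (pt _ †) u∘q≈pt† one₂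

proposition6p5 : (Σ IOS λ X → Σ IOS λ Y → Σ (Hom X Y) λ f → Σ (Hom X Y) λ g → ¬ HasEqualiser f g)
    × (Σ IOS λ X → Σ IOS λ Y → Σ (Hom X Y) λ f → Σ (Hom X Y) λ g → ¬ HasCoequaliser f g)
proposition6p5 = (𝕏 , 𝕏 , idₕ , swₕ , no-equaliser) , (𝕏 , 𝕏 , idₕ , swₕ , no-coequaliser)
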